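{- Let $k$ be a positive integer with $4\mid k$. Then $S_3(k;4)\ge 4k-5$.
   Context: For positive integers $k,r$ with $r\mid k$: a solution to $\mathcal{E}$ is a $k$-tuple $(x_1,\dots,x_k)$ of positive integers (not necessarily distinct) with $\sum_{i=1}^{k-1}x_i=x_k$. Given a coloring $\chi$ of a set of positive integers by non-negative integers, a solution is called $r$-zero-sum if $\sum_{i=1}^k\chi(x_i)\equiv 0\pmod r$. $S_3(k;r)$ denotes the minimum positive integer $n$ such that every coloring $\chi:\{1,\dots,n\}\to\{0,1,\dots,r-1\}$ admits an $r$-zero-sum solution to $\mathcal{E}$ with all $x_i\in\{1,\dots,n\}$ (and $\infty$ if no such $n$ exists). -}

module Defs where

open import Data.Nat using (ℕ; zero; suc; _+_; _≤_; _<_)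
open import Data.Nat.Divisibility using (_∣_)
open import Data.Fin using (Fin; toℕ; inject₁; fromℕ)
open import Data.Product using (Σ; _×_)
open import Relation.Nullary using (¬_)

sumFin : (m : ℕ) → (Fin m → ℕ) → ℕ
sumFin zero    f = 0
sumFin (suc m) f = f Fin.zero + sumFin m (λ i → f (Fin.suc i))

-- (x₁,…,x_{m+1}) is a solution to 𝓔 (k = m+1): x₁ + … + x_m = x_{m+1}
IsSolution : (m : ℕ) → (Fin (suc m) → ℕ) → Set
IsSolution m x = sumFin m (λ i → x (inject₁ i)) ≡ x (fromℕ m)
  where open import Relation.Binary.PropositionalEquality using (_≡_)

-- a coloring of {1,…,n} by {0,…,r-1}; values outside {1,…,n} are irrelevant
Coloring : ℕ → Set
Coloring r = ℕ → Fin r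

HasZeroSumSolution : (m r n : ℕ) → Coloring r → Set
HasZeroSumSolution m r n χ =
  Σ (Fin (suc m) → ℕ) λ x →
    ((i : Fin (suc m)) → 1 ≤ x i × x i ≤ n)
    × IsSolution m x
    × r ∣ sumFin (suc m) (λ i → toℕ (χ (x i)))

Good : (m r n : ℕ) → Set
Good m r n = (χ : Coloring r) → HasZeroSumSolution m r n χ

-- S₃(k;r) ≥ N  (k = m+1), where S₃ is the least positive n that is Good
-- (or ∞): no positive n < N is Good.
S₃≥ : (m r N : ℕ) → Set
S₃≥ m r N = (n : ℕ) → 1 ≤ n → n < N → ¬ Good m r n

module Submission where

-- Write k = m+1; for every n ≤ 4m-2 we exhibit
-- a colouring of {1,…,n} without a 4-zero-sum solution y₁+…+y_m = s.
-- Split ℕ into the zones x ≤ m, m < x < 3m and x ≥ 3m and give every x a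
-- defect d(x): 0 on the low zone, 1 - (x mod 2) on the middle zone and
-- 1 + 2(x mod 2) on the high zone; x gets the colour x + d(x) + 3 mod 4.
-- Since Σ yᵢ = s and 4 ∣ 3k, the colour sum of a solution is congruent to
-- 2s + d(s) + c modulo 4, where c = d(y₁)+…+d(y_m).  As all yᵢ ≥ 1, each
-- yᵢ ≤ s-(m-1) < 3m, so yᵢ has defect at most 1 and only if yᵢ > m; hence
-- (c+1)m ≤ s.  This bounds c by 0, 1 or 2 according to the zone of s, and
-- a parity check in each zone shows 2s + d(s) + c ≢ 0 (mod 4).

open import Defs
open import Data.Nat
  using (ℕ; zero; suc; _+_; _*_; _∸_; _%_; _/_; _≤_; _<_; z≤n; s≤s; s<s⁻¹; _≤?_; _<?_; NonZero)
open import Data.Nat.Properties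
open import Data.Nat.DivMod using (m≡m%n+[m/n]*n; m%n<n; _mod_)
open import Data.Nat.Divisibility using (_∣_; _∣?_; ∣m∣n⇒∣m+n; ∣m+n∣m⇒∣n; n∣m*n; m∣m*n; ∣-trans)
open import Data.Nat.Tactic.RingSolver using (solve-∀)
open import Data.Fin using (Fin; toℕ; inject₁; fromℕ)
open import Data.Fin.Properties using (toℕ-fromℕ<)
open import Data.Product using (_,_; proj₁; proj₂)
open import Relation.Nullary using (¬_; yes; no; contradiction)
open import Relation.Nullary.Decidable using (from-no)
open import Relation.Binary.PropositionalEquality

sumFin-cong : ∀ j {f g : Fin j → ℕ} → (∀ i → f i ≡ g i) → sumFin j f ≡ sumFin j g
sumFin-cong zero    f≡g = refl
sumFin-cong (suc j) f≡g = cong₂ _+_ (f≡g Fin.zero) (sumFin-cong j (λ i → f≡g (Fin.suc i)))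

sumFin-+ : ∀ j (f g : Fin j → ℕ) → sumFin j (λ i → f i + g i) ≡ sumFin j f + sumFin j g
sumFin-+ zero    f g = refl
sumFin-+ (suc j) f g = begin
  f Fin.zero + g Fin.zero + sumFin j (λ i → f (Fin.suc i) + g (Fin.suc i))
    ≡⟨ cong (f Fin.zero + g Fin.zero +_) (sumFin-+ j (λ i → f (Fin.suc i)) (λ i → g (Fin.suc i))) ⟩
  f Fin.zero + g Fin.zero + (sumFin j (λ i → f (Fin.suc i)) + sumFin j (λ i → g (Fin.suc i)))
    ≡⟨ interchange (f Fin.zero) (g Fin.zero) _ _ ⟩
  f Fin.zero + sumFin j (λ i → f (Fin.suc i)) + (g Fin.zero + sumFin j (λ i → g (Fin.suc i))) ∎
  where
  open ≡-Reasoning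
  interchange : ∀ a b c d → a + b + (c + d) ≡ a + c + (b + d)
  interchange = solve-∀

sumFin-*ʳ : ∀ j (f : Fin j → ℕ) a → sumFin j (λ i → f i * a) ≡ sumFin j f * a
sumFin-*ʳ zero    f a = refl
sumFin-*ʳ (suc j) f a = begin
  f Fin.zero * a + sumFin j (λ i → f (Fin.suc i) * a)
    ≡⟨ cong (f Fin.zero * a +_) (sumFin-*ʳ j (λ i → f (Fin.suc i)) a) ⟩
  f Fin.zero * a + sumFin j (λ i → f (Fin.suc i)) * a
    ≡⟨ *-distribʳ-+ a (f Fin.zero) _ ⟨
  (f Fin.zero + sumFin j (λ i → f (Fin.suc i))) * a ∎
  where open ≡-Reasoning

sumFin-const : ∀ j a → sumFin j (λ _ → a) ≡ j * a
sumFin-const zero    a = refl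
sumFin-const (suc j) a = cong (a +_) (sumFin-const j a)

sumFin-suc : ∀ j (f : Fin j → ℕ) → sumFin j (λ i → suc (f i)) ≡ j + sumFin j f
sumFin-suc j f = begin
  sumFin j (λ i → 1 + f i)       ≡⟨ sumFin-+ j (λ _ → 1) f ⟩
  sumFin j (λ _ → 1) + sumFin j f ≡⟨ cong (_+ sumFin j f) (sumFin-const j 1) ⟩
  j * 1 + sumFin j f              ≡⟨ cong (_+ sumFin j f) (*-identityʳ j) ⟩
  j + sumFin j f                  ∎
  where open ≡-Reasoning

sumFin-mono : ∀ j {f g : Fin j → ℕ} → (∀ i → f i ≤ g i) → sumFin j f ≤ sumFin j g
sumFin-mono zero    f≤g = z≤n
sumFin-mono (suc j) f≤g = +-mono-≤ (f≤g Fin.zero) (sumFin-mono j (λ i → f≤g (Fin.suc i)))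

sumFin-last : ∀ m (g : Fin (suc m) → ℕ) →
              sumFin (suc m) g ≡ sumFin m (λ i → g (inject₁ i)) + g (fromℕ m)
sumFin-last zero    g = +-comm (g Fin.zero) 0
sumFin-last (suc m) g = begin
  g Fin.zero + sumFin (suc m) (λ i → g (Fin.suc i))
    ≡⟨ cong (g Fin.zero +_) (sumFin-last m (λ i → g (Fin.suc i))) ⟩
  g Fin.zero + (sumFin m (λ i → g (Fin.suc (inject₁ i))) + g (fromℕ (suc m)))
    ≡⟨ +-assoc (g Fin.zero) _ _ ⟨
  g Fin.zero + sumFin m (λ i → g (Fin.suc (inject₁ i))) + g (fromℕ (suc m)) ∎
  where open ≡-Reasoning

sumFin-positive : ∀ j {f : Fin j → ℕ} → (∀ i → 1 ≤ f i) → j ≤ sumFin j f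
sumFin-positive zero    pos = z≤n
sumFin-positive (suc j) pos = +-mono-≤ (pos Fin.zero) (sumFin-positive j (λ i → pos (Fin.suc i)))

sumFin-summand : ∀ j {f : Fin j → ℕ} → (∀ i → 1 ≤ f i) → ∀ i → f i + j ≤ suc (sumFin j f)
sumFin-summand (suc j) {f} pos Fin.zero = begin
  f Fin.zero + suc j                                ≡⟨ +-suc (f Fin.zero) j ⟩
  suc (f Fin.zero + j)                              ≤⟨ s≤s (+-monoʳ-≤ (f Fin.zero) rest≥j) ⟩
  suc (f Fin.zero + sumFin j (λ i → f (Fin.suc i))) ∎
  where
  open ≤-Reasoning
  rest≥j : j ≤ sumFin j (λ i → f (Fin.suc i))
  rest≥j = sumFin-positive j (λ i → pos (Fin.suc i))
sumFin-summand (suc j) {f} pos (Fin.suc i) = begin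
  f (Fin.suc i) + suc j                              ≡⟨ +-suc (f (Fin.suc i)) j ⟩
  suc (f (Fin.suc i) + j)                            ≤⟨ s≤s (sumFin-summand j (λ i → pos (Fin.suc i)) i) ⟩
  suc (1 + sumFin j (λ i → f (Fin.suc i)))           ≤⟨ s≤s (+-monoˡ-≤ _ (pos Fin.zero)) ⟩
  suc (f Fin.zero + sumFin j (λ i → f (Fin.suc i))) ∎
  where open ≤-Reasoning

sumFin-mod : ∀ n .{{_ : NonZero n}} j (f : Fin j → ℕ) →
             n ∣ sumFin j (λ i → f i % n) → n ∣ sumFin j f
sumFin-mod n j f n∣residues =
  subst (n ∣_) (sym decomposition) (∣m∣n⇒∣m+n n∣residues (n∣m*n (sumFin j (λ i → f i / n))))
  where
  open ≡-Reasoning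
  decomposition : sumFin j f ≡ sumFin j (λ i → f i % n) + sumFin j (λ i → f i / n) * n
  decomposition = begin
    sumFin j f                                     ≡⟨ sumFin-cong j (λ i → m≡m%n+[m/n]*n (f i) n) ⟩
    sumFin j (λ i → f i % n + f i / n * n)          ≡⟨ sumFin-+ j _ _ ⟩
    sumFin j (λ i → f i % n) + sumFin j (λ i → f i / n * n)
      ≡⟨ cong (sumFin j (λ i → f i % n) +_) (sumFin-*ʳ j (λ i → f i / n) n) ⟩
    sumFin j (λ i → f i % n) + sumFin j (λ i → f i / n) * n ∎

solution-total : ∀ m (x : Fin (suc m) → ℕ) → IsSolution m x →
                 sumFin (suc m) x ≡ 2 * x (fromℕ m)
solution-total m x sol = begin
  sumFin (suc m) x                                   ≡⟨ sumFin-last m x ⟩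
  sumFin m (λ i → x (inject₁ i)) + x (fromℕ m)       ≡⟨ cong (_+ x (fromℕ m)) sol ⟩
  x (fromℕ m) + x (fromℕ m)                          ≡⟨ cong (x (fromℕ m) +_) (+-identityʳ _) ⟨
  2 * x (fromℕ m)                                    ∎
  where open ≡-Reasoning

solution-input-bound : ∀ m (x : Fin (suc m) → ℕ) → (∀ i → 1 ≤ x i) → IsSolution m x →
                       ∀ i → x (inject₁ i) + m ≤ suc (x (fromℕ m))
solution-input-bound m x pos sol i =
  subst (λ t → x (inject₁ i) + m ≤ suc t) sol (sumFin-summand m (λ j → pos (inject₁ j)) i)

data Zone (m x : ℕ) : Set where
  low  : x ≤ m → Zone m x
  mid  : m < x → x < 3 * m → Zone m x
  high : 3 * m ≤ x → Zone m x

zone : ∀ m x → Zone m x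
zone m x with x ≤? m | x <? 3 * m
... | yes x≤m | _        = low x≤m
... | no x≰m  | yes x<3m = mid (≰⇒> x≰m) x<3m
... | no _    | no x≮3m  = high (≮⇒≥ x≮3m)

-- The defect of x: how far its colour is from x - 1 modulo 4.
defect : ℕ → ℕ → ℕ
defect m x with zone m x
... | low _   = 0
... | mid _ _ = 1 ∸ x % 2
... | high _  = 1 + 2 * (x % 2)

-- x is coloured by (x - 1) + d(x) modulo 4, written x + d(x) + 3.
colour : ℕ → ℕ → ℕ
colour m x = 3 + (x + defect m x)

colouring : ℕ → Coloring 4
colouring m x = colour m x mod 4

input-defect : ∀ m y → 1 ≤ y → y < 3 * m → suc (defect m y * m) ≤ y
input-defect m y 1≤y y<3m with zone m y
... | low _      = 1≤y
... | mid m<y _  = ≤-trans (s≤s defect≤1) m<y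
  where
  defect≤1 : (1 ∸ y % 2) * m ≤ m
  defect≤1 = ≤-trans (*-monoˡ-≤ m (m∸n≤m 1 (y % 2))) (≤-reflexive (*-identityˡ m))
... | high 3m≤y = contradiction 3m≤y (<⇒≱ y<3m)

colour-sum : ∀ m (x : Fin (suc m) → ℕ) → IsSolution m x →
             sumFin (suc m) (λ i → colour m (x i))
               ≡ suc m * 3
                 + (2 * x (fromℕ m) + (defect m (x (fromℕ m)) + sumFin m (λ i → defect m (x (inject₁ i)))))
colour-sum m x sol = begin
  sumFin (suc m) (λ i → 3 + (x i + defect m (x i)))
    ≡⟨ sumFin-+ (suc m) (λ _ → 3) (λ i → x i + defects i) ⟩
  sumFin (suc m) (λ _ → 3) + sumFin (suc m) (λ i → x i + defect m (x i))
    ≡⟨ cong₂ _+_ (sumFin-const (suc m) 3) (sumFin-+ (suc m) x defects) ⟩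
  suc m * 3 + (sumFin (suc m) x + sumFin (suc m) (λ i → defect m (x i)))
    ≡⟨ cong₂ (λ a b → suc m * 3 + (a + b)) (solution-total m x sol) (sumFin-last m defects) ⟩
  suc m * 3 + (2 * s + (sumFin m (λ i → defect m (x (inject₁ i))) + defect m s))
    ≡⟨ cong (λ b → suc m * 3 + (2 * s + b)) (+-comm _ (defect m s)) ⟩
  suc m * 3 + (2 * s + (defect m s + sumFin m (λ i → defect m (x (inject₁ i))))) ∎
  where
  open ≡-Reasoning
  s : ℕ
  s = x (fromℕ m)
  defects : Fin (suc m) → ℕ
  defects i = defect m (x i)

-- Modulo 4, twice a number only depends on its parity.
double-mod-4 : ∀ s t → 4 ∣ 2 * s + t → 4 ∣ 2 * (s % 2) + t
double-mod-4 s t 4∣2s+t = ∣m+n∣m⇒∣n (subst (4 ∣_) halve 4∣2s+t) (n∣m*n (s / 2))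
  where
  regroup : ∀ p h t → 2 * (p + h * 2) + t ≡ h * 4 + (2 * p + t)
  regroup = solve-∀
  halve : 2 * s + t ≡ s / 2 * 4 + (2 * (s % 2) + t)
  halve = trans (cong (λ z → 2 * z + t) (m≡m%n+[m/n]*n s 2)) (regroup (s % 2) (s / 2) t)

coefficient-bound : ∀ {m c b s} → suc c * m ≤ s → s < suc b * m → c < b
coefficient-bound {m} {c} {b} lower upper = s<s⁻¹ (*-cancelʳ-< m (suc c) (suc b) (≤-<-trans lower upper))

-- If 4 ∣ m+1 then m ≡ 3 (mod 4), so 2m ≡ 2 (mod 4).
double-pred-not-div : ∀ {m} → 4 ∣ suc m → ¬ 4 ∣ 2 * m
double-pred-not-div {m} 4∣m+1 4∣2m = from-no (4 ∣? 2) (∣m+n∣m⇒∣n 4∣2m+2 4∣2m)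
  where
  4∣2m+2 : 4 ∣ 2 * m + 2
  4∣2m+2 = subst (4 ∣_) (trans (*-suc 2 m) (+-comm 2 (2 * m))) (∣-trans 4∣m+1 (n∣m*n 2))

low-zone : ∀ {m c s} → 4 ∣ suc m → suc c * m ≤ s → s ≤ m → ¬ 4 ∣ 2 * s + c
low-zone {zero}  4∣1 _ _ = contradiction 4∣1 (from-no (4 ∣? 1))
low-zone {suc m} {zero} {s} 4∣k m≤s s≤m 4∣2s =
  double-pred-not-div 4∣k (subst (λ t → 4 ∣ 2 * t) s≡m (subst (4 ∣_) (+-identityʳ (2 * s)) 4∣2s))
  where
  s≡m : s ≡ suc m
  s≡m = ≤-antisym s≤m (subst (_≤ s) (+-identityʳ (suc m)) m≤s)
low-zone {suc m} {suc c} _ 2m≤s s≤m = contradiction (≤-trans 2m≤s s≤m) (m+1+n≰m (suc m))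

mid-residue : ∀ p c → p < 2 → c < 2 → ¬ 4 ∣ 2 * p + ((1 ∸ p) + c)
mid-residue 0 0 _ _ = from-no (4 ∣? 1)
mid-residue 0 1 _ _ = from-no (4 ∣? 2)
mid-residue 1 0 _ _ = from-no (4 ∣? 2)
mid-residue 1 1 _ _ = from-no (4 ∣? 3)
mid-residue (suc (suc _)) _ (s≤s (s≤s ())) _
mid-residue 0 (suc (suc _)) _ (s≤s (s≤s ()))
mid-residue 1 (suc (suc _)) _ (s≤s (s≤s ()))

mid-zone : ∀ {m c s} → suc c * m ≤ s → s < 3 * m → ¬ 4 ∣ 2 * s + ((1 ∸ s % 2) + c)
mid-zone {s = s} lower upper 4∣ =
  mid-residue (s % 2) _ (m%n<n s 2) (coefficient-bound lower upper) (double-mod-4 s _ 4∣)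

high-residue : ∀ p c → p < 2 → c < 3 → ¬ 4 ∣ 2 * p + ((1 + 2 * p) + c)
high-residue 0 0 _ _ = from-no (4 ∣? 1)
high-residue 0 1 _ _ = from-no (4 ∣? 2)
high-residue 0 2 _ _ = from-no (4 ∣? 3)
high-residue 1 0 _ _ = from-no (4 ∣? 5)
high-residue 1 1 _ _ = from-no (4 ∣? 6)
high-residue 1 2 _ _ = from-no (4 ∣? 7)
high-residue (suc (suc _)) _ (s≤s (s≤s ())) _
high-residue 0 (suc (suc (suc _))) _ (s≤s (s≤s (s≤s ())))
high-residue 1 (suc (suc (suc _))) _ (s≤s (s≤s (s≤s ())))

high-zone : ∀ {m c s} → suc c * m ≤ s → s < 4 * m → ¬ 4 ∣ 2 * s + ((1 + 2 * (s % 2)) + c)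
high-zone {s = s} lower upper 4∣ =
  high-residue (s % 2) _ (m%n<n s 2) (coefficient-bound lower upper) (double-mod-4 s _ 4∣)

no-zero-sum : ∀ {m c s} → 4 ∣ suc m → suc c * m ≤ s → s < 4 * m →
              ¬ 4 ∣ 2 * s + (defect m s + c)
no-zero-sum {m} {c} {s} 4∣k lower upper with zone m s
... | low s≤m      = low-zone 4∣k lower s≤m
... | mid _ s<3m   = mid-zone lower s<3m
... | high _       = high-zone lower upper

zero-sum-residue : ∀ m (x : Fin (suc m) → ℕ) → 4 ∣ suc m → IsSolution m x →
                   4 ∣ sumFin (suc m) (λ i → toℕ (colouring m (x i))) →
                   4 ∣ 2 * x (fromℕ m) + (defect m (x (fromℕ m)) + sumFin m (λ i → defect m (x (inject₁ i))))
zero-sum-residue m x 4∣k sol zero-sum = ∣m+n∣m⇒∣n colours-div (∣-trans 4∣k (m∣m*n 3))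
  where
  residues-div : 4 ∣ sumFin (suc m) (λ i → colour m (x i) % 4)
  residues-div = subst (4 ∣_) (sumFin-cong (suc m) (λ i → toℕ-fromℕ< (m%n<n (colour m (x i)) 4))) zero-sum
  colours-div : 4 ∣ suc m * 3 + (2 * x (fromℕ m) + (defect m (x (fromℕ m)) + sumFin m (λ i → defect m (x (inject₁ i)))))
  colours-div = subst (4 ∣_) (colour-sum m x sol) (sumFin-mod 4 (suc m) (λ i → colour m (x i)) residues-div)

-- In a solution with positive entries and output s < 4m - 1, every input
-- lies below 3m, so the input defects c satisfy (c+1)m ≤ s.
defects-bound : ∀ m (x : Fin (suc m) → ℕ) → (∀ i → 1 ≤ x i) → IsSolution m x →
                suc (x (fromℕ m)) < 4 * m →
                suc (sumFin m (λ i → defect m (x (inject₁ i)))) * m ≤ x (fromℕ m)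
defects-bound m x pos sol s+1<4m = subst₂ _≤_
    (trans (sumFin-suc m _) (cong (m +_) (sumFin-*ʳ m (λ i → defect m (x (inject₁ i))) m))) sol
    (sumFin-mono m (λ i → input-defect m (x (inject₁ i)) (pos (inject₁ i)) (input-small i)))
  where
  input-small : ∀ i → x (inject₁ i) < 3 * m
  input-small i = +-cancelˡ-< m (x (inject₁ i)) (3 * m)
    (subst (_< 4 * m) (+-comm (x (inject₁ i)) m) (≤-<-trans (solution-input-bound m x pos sol i) s+1<4m))

<∸1⇒suc< : ∀ {a b} → a < b ∸ 1 → suc a < b
<∸1⇒suc< {b = suc b} a<b = s≤s a<b

theorem6 : (m : ℕ) → 4 ∣ suc m → S₃≥ m 4 (4 * suc m ∸ 5)
theorem6 m 4∣k n _ n<N good with good (colouring m)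
... | x , range , sol , zero-sum =
  no-zero-sum 4∣k (defects-bound m x positive sol s+1<4m) (<-trans (n<1+n s) s+1<4m)
    (zero-sum-residue m x 4∣k sol zero-sum)
  where
  s : ℕ
  s = x (fromℕ m)
  positive : ∀ i → 1 ≤ x i
  positive i = proj₁ (range i)
  s+1<4m : suc s < 4 * m
  s+1<4m = <∸1⇒suc<
    (subst (λ t → s < t ∸ 5) (*-suc 4 m) (≤-<-trans (proj₂ (range (fromℕ m))) n<N))
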